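{- For integers $n,k,l\ge 0$ with $3k+2l\le n$, the number $g^{k,l}_n$ of tilings of the honeycomb strip $H_n$ using exactly $k$ trimers, $l$ slanted dimers and $n-3k-2l$ monomers is $$g^{k,l}_n=\binom{n-3k-l}{l}\binom{n-2k-l}{k}.$$
   Context: The honeycomb strip $H_n$ consists of $n$ regular hexagons numbered $1,\dots,n$ arranged in two rows (odd-numbered on the bottom, even-numbered on top), hexagon $i$ sharing an edge with hexagons $i\pm1$ and $i\pm2$. The allowed tiles are: monomers $\{i\}$, slanted dimers $\{i,i+1\}$, and trimers $\{i,i+1,i+2\}$ (horizontal dimers $\{i,i+2\}$ are not allowed); a tiling is a partition of the hexagons of $H_n$ into such tiles. -}

module Defs where

open import Data.Nat using (ℕ; zero; suc; _+_; _<_; _≡ᵇ_)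
open import Data.List using (List; []; _∷_; length; filter; concatMap; map; upTo)
open import Data.List.Relation.Binary.Permutation.Propositional using (_↭_)
open import Data.List.Relation.Unary.All using (All)
open import Data.List.Relation.Unary.Linked using (Linked)
open import Data.Product using (_×_; Σ)
open import Data.Sum using (_⊎_)
open import Relation.Binary.PropositionalEquality using (_≡_)

-- Hexagons of H_n are numbered 0,…,n-1 (the paper's 1,…,n shifted by one).
-- A tile is given by its least hexagon and its size:
--   size 1 = monomer {i}, size 2 = slanted dimer {i,i+1},
--   size 3 = trimer {i,i+1,i+2}.  Horizontal dimers {i,i+2} are not tiles.
record Tile : Set where
  constructor tile
  field
    start : ℕ
    size  : ℕ
open Tile public

ValidSize : ℕ → Set
ValidSize s = (s ≡ 1) ⊎ (s ≡ 2) ⊎ (s ≡ 3)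

cells : Tile → List ℕ
cells (tile i s) = map (i +_) (upTo s)

-- A tiling of H_n, represented canonically as the list of its tiles sorted by
-- strictly increasing least hexagon (so each set partition has exactly one
-- representation); the tiles partition {0,…,n-1}: every hexagon is covered by
-- exactly one tile (the concatenation of their cell lists is a permutation of
-- the hexagon list).
IsTiling : ℕ → List Tile → Set
IsTiling n ts =
  All (λ t → ValidSize (size t)) ts
  × Linked (λ t u → start t < start u) ts
  × (concatMap cells ts ↭ upTo n)

countSize : ℕ → List Tile → ℕ
countSize s ts = length (filter (λ t → size t Data.Nat.≟ s) ts)

-- Sorted by least hexagon, each tile of a tiling starts where the previous one ends, so a
-- tiling of H_n is determined by its word of tile sizes, and the tilings correspond exactly to
-- the words over {1,2,3} summing to n.  A word with k threes, l twos and m = n-3k-2l ones is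
-- obtained in exactly one way by first interleaving l twos into m ones (C(m+l,l) ways) and then
-- k threes into the resulting word of length l+m (C(l+m+k,k) ways).  Since m+l = n-3k-l and
-- l+m+k = n-2k-l, this gives the two binomials.

module Submission where

open import Defs
open import Data.Nat using (ℕ; zero; suc; _+_; _*_; _∸_; _≤_; _<_; _≟_; s≤s; z≤n)
open import Data.Nat.Properties
  using (suc-injective; +-suc; +-identityʳ; ≤-refl; <⇒≤; ≤-trans; <-trans; ≤-antisym; m<m+n; m+n∸m≡n;
         m≤n⇒∃[o]m+o≡n)
open import Data.Nat.Tactic.RingSolver using (solve-∀)
open import Data.Nat.Combinatorics using (_C_; nCn≡1; nCk+nC[k+1]≡[n+1]C[k+1])
open import Data.Nat.ListAction using (sum)
open import Data.List using (List; []; _∷_; length; map; concatMap; upTo; applyUpTo; replicate; _++_)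
open import Data.List.Properties
  using (∷-injectiveʳ; length-map; length-++; length-replicate; map-upTo; filter-accept; filter-reject)
open import Data.List.Relation.Unary.All using (All; []; _∷_)
import Data.List.Relation.Unary.All as All
import Data.List.Relation.Unary.All.Properties as All
open import Data.List.Relation.Unary.Any using (here; there)
open import Data.List.Relation.Unary.Linked as Linked using (Linked; []; [-]; _∷_)
open import Data.List.Relation.Unary.Linked.Properties using (Linked⇒AllPairs)
open import Data.List.Relation.Unary.Unique.Propositional using (Unique; []; _∷_)
import Data.List.Relation.Unary.Unique.Propositional.Properties as Unique
open import Data.List.Membership.Propositional using (_∈_; find; lose)
open import Data.List.Membership.Propositional.Properties
  using (∈-map⁺; ∈-map⁻; ∈-++⁺ˡ; ∈-++⁺ʳ; ∈-++⁻; ∈-concatMap⁺; ∈-concatMap⁻)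
open import Data.List.Relation.Binary.Permutation.Propositional
  using (_↭_; ↭-reflexive; ↭-sym; ↭-trans)
open import Data.List.Relation.Binary.Permutation.Propositional.Properties
  using (↭-length; ∈-resp-↭; drop-∷)
open import Data.Product using (Σ; _×_; _,_; proj₁; proj₂)
open import Data.Sum using (inj₁; inj₂)
open import Data.Empty using (⊥-elim)
open import Relation.Nullary using (¬_; yes; no)
open import Relation.Binary.Definitions using (DecidableEquality)
open import Function using (_∘_)
open import Function.Bundles using (_⇔_; mk⇔; module Equivalence)
open import Relation.Binary.PropositionalEquality
  using (_≡_; _≢_; refl; sym; trans; cong; cong₂; subst; module ≡-Reasoning)

Unique-concatMap⁺ : ∀ {A B : Set} (f : A → List B) (g : B → A) {xs : List A} →
                    (∀ {x y} → x ∈ xs → y ∈ f x → g y ≡ x) →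
                    (∀ {x} → x ∈ xs → Unique (f x)) →
                    Unique xs → Unique (concatMap f xs)
Unique-concatMap⁺ f g {[]} g-retracts f-unique [] = []
Unique-concatMap⁺ f g {x ∷ xs} g-retracts f-unique (x∉xs ∷ xs-unique) =
  Unique.++⁺ (f-unique (here refl))
             (Unique-concatMap⁺ f g (g-retracts ∘ there) (f-unique ∘ there) xs-unique)
             disjoint
  where
  disjoint : ∀ {z} → ¬ (z ∈ f x × z ∈ concatMap f xs)
  disjoint (z∈fx , z∈fxs) with find (∈-concatMap⁻ f {xs = xs} z∈fxs)
  ... | y , y∈xs , z∈fy =
    All.lookup x∉xs y∈xs (trans (sym (g-retracts (here refl) z∈fx)) (g-retracts (there y∈xs) z∈fy))

length-concatMap-const : ∀ {A B : Set} (f : A → List B) {c : ℕ} {xs : List A} →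
                         (∀ {x} → x ∈ xs → length (f x) ≡ c) →
                         length (concatMap f xs) ≡ length xs * c
length-concatMap-const f {xs = []} const = refl
length-concatMap-const f {xs = x ∷ xs} const =
  trans (length-++ (f x)) (cong₂ _+_ (const (here refl)) (length-concatMap-const f (const ∘ there)))

module Interleavings {A : Set} (_≟ᴬ_ : DecidableEquality A) where

  count : A → List A → ℕ
  count a [] = 0
  count a (x ∷ w) with x ≟ᴬ a
  ... | yes _ = suc (count a w)
  ... | no  _ = count a w

  erase : A → List A → List A
  erase a [] = []
  erase a (x ∷ w) with x ≟ᴬ a
  ... | yes _ = erase a w
  ... | no  _ = x ∷ erase a w

  count-here : ∀ a w → count a (a ∷ w) ≡ suc (count a w)
  count-here a w with a ≟ᴬ a
  ... | yes _  = refl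
  ... | no a≢a = ⊥-elim (a≢a refl)

  count-there : ∀ {a x} w → x ≢ a → count a (x ∷ w) ≡ count a w
  count-there {a} {x} w x≢a with x ≟ᴬ a
  ... | yes x≡a = ⊥-elim (x≢a x≡a)
  ... | no  _   = refl

  erase-here : ∀ a w → erase a (a ∷ w) ≡ erase a w
  erase-here a w with a ≟ᴬ a
  ... | yes _  = refl
  ... | no a≢a = ⊥-elim (a≢a refl)

  erase-fresh : ∀ a w → count a w ≡ 0 → erase a w ≡ w
  erase-fresh a [] _ = refl
  erase-fresh a (x ∷ w) fresh with x ≟ᴬ a
  erase-fresh a (x ∷ w) () | yes _
  ... | no _ = cong (x ∷_) (erase-fresh a w fresh)

  count-erase-self : ∀ a w → count a (erase a w) ≡ 0
  count-erase-self a [] = refl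
  count-erase-self a (x ∷ w) with x ≟ᴬ a
  ... | yes _   = count-erase-self a w
  ... | no  x≢a = trans (count-there (erase a w) x≢a) (count-erase-self a w)

  count-erase : ∀ {a b} w → b ≢ a → count b (erase a w) ≡ count b w
  count-erase [] _ = refl
  count-erase {a} {b} (x ∷ w) b≢a with x ≟ᴬ a
  ... | yes refl = trans (count-erase w b≢a) (sym (count-there w (b≢a ∘ sym)))
  ... | no  _ with x ≟ᴬ b
  ...   | yes _ = cong suc (count-erase w b≢a)
  ...   | no  _ = count-erase w b≢a

  length-count+erase : ∀ a w → length w ≡ count a w + length (erase a w)
  length-count+erase a [] = refl
  length-count+erase a (x ∷ w) with x ≟ᴬ a
  ... | yes _ = cong suc (length-count+erase a w)
  ... | no  _ = trans (cong suc (length-count+erase a w)) (sym (+-suc (count a w) _))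

  All-erase⁻ : ∀ {P : A → Set} {a} w → All P (erase a w) → P a → All P w
  All-erase⁻ [] _ _ = []
  All-erase⁻ {a = a} (x ∷ w) all pa with x ≟ᴬ a
  ... | yes refl = pa ∷ All-erase⁻ w all pa
  All-erase⁻ (x ∷ w) (px ∷ all) pa | no _ = px ∷ All-erase⁻ w all pa

  count-replicate : ∀ a m → count a (replicate m a) ≡ m
  count-replicate a zero    = refl
  count-replicate a (suc m) = trans (count-here a (replicate m a)) (cong suc (count-replicate a m))

  count-replicate-≢ : ∀ {a b} m → b ≢ a → count b (replicate m a) ≡ 0
  count-replicate-≢ zero    _   = refl
  count-replicate-≢ (suc m) b≢a = trans (count-there _ (b≢a ∘ sym)) (count-replicate-≢ m b≢a)

  interleavings : A → ℕ → List A → List (List A)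
  interleavings a zero    w       = w ∷ []
  interleavings a (suc k) []      = map (a ∷_) (interleavings a k [])
  interleavings a (suc k) (x ∷ w) =
    map (a ∷_) (interleavings a k (x ∷ w)) ++ map (x ∷_) (interleavings a (suc k) w)

  ∈-interleavings⁻ : ∀ a k w {v} → v ∈ interleavings a k w →
                     count a v ≡ k + count a w × erase a v ≡ erase a w
  ∈-interleavings⁻ a zero w (here refl) = refl , refl
  ∈-interleavings⁻ a (suc k) [] v∈ with ∈-map⁻ (a ∷_) v∈
  ... | u , u∈ , refl =
    let c , e = ∈-interleavings⁻ a k [] u∈
    in trans (count-here a u) (cong suc c) , trans (erase-here a u) e
  ∈-interleavings⁻ a (suc k) (x ∷ w) v∈
    with ∈-++⁻ (map (a ∷_) (interleavings a k (x ∷ w))) v∈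
  ... | inj₁ v∈₁ with ∈-map⁻ (a ∷_) v∈₁
  ...   | u , u∈ , refl =
    let c , e = ∈-interleavings⁻ a k (x ∷ w) u∈
    in trans (count-here a u) (cong suc c) , trans (erase-here a u) e
  ∈-interleavings⁻ a (suc k) (x ∷ w) v∈ | inj₂ v∈₂ with ∈-map⁻ (x ∷_) v∈₂
  ...   | u , u∈ , refl with ∈-interleavings⁻ a (suc k) w u∈ | x ≟ᴬ a
  ...     | c , e | yes refl = trans (cong suc c) (sym (+-suc (suc k) (count a w))) , e
  ...     | c , e | no  _    = c , cong (x ∷_) e

  ∷-∈-interleavings : ∀ a k w {v} → v ∈ interleavings a k w →
                      a ∷ v ∈ interleavings a (suc k) w
  ∷-∈-interleavings a k []      v∈ = ∈-map⁺ (a ∷_) v∈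
  ∷-∈-interleavings a k (x ∷ w) v∈ = ∈-++⁺ˡ (∈-map⁺ (a ∷_) v∈)

  ∈-interleavings⁺ : ∀ a k v → count a v ≡ k → v ∈ interleavings a k (erase a v)
  ∈-interleavings⁺ a zero    v       c = here (sym (erase-fresh a v c))
  ∈-interleavings⁺ a (suc k) []      ()
  ∈-interleavings⁺ a (suc k) (y ∷ v) c with y ≟ᴬ a
  ... | yes refl = ∷-∈-interleavings a k (erase a v) (∈-interleavings⁺ a k v (suc-injective c))
  ... | no  _    = ∈-++⁺ʳ (map (a ∷_) (interleavings a k (y ∷ erase a v)))
                          (∈-map⁺ (y ∷_) (∈-interleavings⁺ a (suc k) v c))

  count≡0-∷⁻ : ∀ {a x} w → count a (x ∷ w) ≡ 0 → x ≢ a × count a w ≡ 0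
  count≡0-∷⁻ {a} {x} w fresh with x ≟ᴬ a
  count≡0-∷⁻ w () | yes _
  ... | no x≢a = x≢a , fresh

  interleavings-unique : ∀ a k w → count a w ≡ 0 → Unique (interleavings a k w)
  interleavings-unique a zero    w       _     = [] ∷ []
  interleavings-unique a (suc k) []      fresh =
    Unique.map⁺ ∷-injectiveʳ (interleavings-unique a k [] fresh)
  interleavings-unique a (suc k) (x ∷ w) fresh =
    Unique.++⁺ (Unique.map⁺ ∷-injectiveʳ (interleavings-unique a k (x ∷ w) fresh))
               (Unique.map⁺ ∷-injectiveʳ (interleavings-unique a (suc k) w w-fresh))
               disjoint
    where
    x≢a = proj₁ (count≡0-∷⁻ w fresh)
    w-fresh = proj₂ (count≡0-∷⁻ w fresh)
    disjoint : ∀ {v} → ¬ (v ∈ map (a ∷_) (interleavings a k (x ∷ w))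
                          × v ∈ map (x ∷_) (interleavings a (suc k) w))
    disjoint (p , q) with ∈-map⁻ (a ∷_) p | ∈-map⁻ (x ∷_) q
    ... | _ , _ , refl | _ , _ , refl = x≢a refl

  length-interleavings : ∀ a k w → length (interleavings a k w) ≡ (length w + k) C k
  length-interleavings a zero    w       = refl
  length-interleavings a (suc k) []      = begin
    length (map (a ∷_) (interleavings a k [])) ≡⟨ length-map (a ∷_) (interleavings a k []) ⟩
    length (interleavings a k [])              ≡⟨ length-interleavings a k [] ⟩
    k C k                                      ≡⟨ nCn≡1 k ⟩
    1                                          ≡⟨ nCn≡1 (suc k) ⟨
    suc k C suc k                              ∎
    where open ≡-Reasoning
  length-interleavings a (suc k) (x ∷ w) = begin
    length (map (a ∷_) now ++ map (x ∷_) later)          ≡⟨ length-++ (map (a ∷_) now) ⟩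
    length (map (a ∷_) now) + length (map (x ∷_) later) ≡⟨ cong₂ _+_ (length-map (a ∷_) now)
                                                                     (length-map (x ∷_) later) ⟩
    length now + length later                           ≡⟨ cong₂ _+_ (length-interleavings a k (x ∷ w))
                                                                     (length-interleavings a (suc k) w) ⟩
    (suc (length w) + k) C k + (length w + suc k) C suc k
      ≡⟨ cong (λ n → n C k + (length w + suc k) C suc k) (sym (+-suc (length w) k)) ⟩
    (length w + suc k) C k + (length w + suc k) C suc k
      ≡⟨ nCk+nC[k+1]≡[n+1]C[k+1] (length w + suc k) k ⟩
    suc (length w + suc k) C suc k
      ∎
    where
    open ≡-Reasoning
    now   = interleavings a k (x ∷ w)
    later = interleavings a (suc k) w

  ∈-interleavings : ∀ a k w v → count a w ≡ 0 →
                    v ∈ interleavings a k w ⇔ (count a v ≡ k × erase a v ≡ w)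
  ∈-interleavings a k w v fresh = mk⇔ sound complete
    where
    sound : v ∈ interleavings a k w → count a v ≡ k × erase a v ≡ w
    sound v∈ = let c , e = ∈-interleavings⁻ a k w v∈
               in trans c (trans (cong (k +_) fresh) (+-identityʳ k)) , trans e (erase-fresh a w fresh)
    complete : count a v ≡ k × erase a v ≡ w → v ∈ interleavings a k w
    complete (c , refl) = ∈-interleavings⁺ a k v c

  length-∈-interleavings : ∀ a k w {v} → count a w ≡ 0 → v ∈ interleavings a k w →
                           length v ≡ k + length w
  length-∈-interleavings a k w {v} fresh v∈ =
    let c , e = Equivalence.to (∈-interleavings a k w v fresh) v∈
    in trans (length-count+erase a v) (cong₂ (λ c u → c + length u) c e)

open Interleavings _≟_

HasParts : ℕ → ℕ → ℕ → List ℕ → Set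
HasParts k l m w = All ValidSize w × count 3 w ≡ k × count 2 w ≡ l × count 1 w ≡ m

twosAndOnes : ℕ → ℕ → List (List ℕ)
twosAndOnes l m = interleavings 2 l (replicate m 1)

compositions : ℕ → ℕ → ℕ → List (List ℕ)
compositions k l m = concatMap (interleavings 3 k) (twosAndOnes l m)

count-2-ones≡0 : ∀ m → count 2 (replicate m 1) ≡ 0
count-2-ones≡0 m = count-replicate-≢ m (λ ())

∈-twosAndOnes : ∀ l m u → u ∈ twosAndOnes l m ⇔ (count 2 u ≡ l × erase 2 u ≡ replicate m 1)
∈-twosAndOnes l m u = ∈-interleavings 2 l (replicate m 1) u (count-2-ones≡0 m)

∈-twosAndOnes⇒count3≡0 : ∀ l m {u} → u ∈ twosAndOnes l m → count 3 u ≡ 0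
∈-twosAndOnes⇒count3≡0 l m {u} u∈ = begin
  count 3 u                     ≡⟨ count-erase u (λ ()) ⟨
  count 3 (erase 2 u)           ≡⟨ cong (count 3) (proj₂ (Equivalence.to (∈-twosAndOnes l m u) u∈)) ⟩
  count 3 (replicate m 1)       ≡⟨ count-replicate-≢ m (λ ()) ⟩
  0                             ∎
  where open ≡-Reasoning

erase-2-3≡ones : ∀ w → All ValidSize w → erase 2 (erase 3 w) ≡ replicate (count 1 w) 1
erase-2-3≡ones []      []                                 = refl
erase-2-3≡ones (1 ∷ w) (inj₁ refl ∷ valid)               = cong (1 ∷_) (erase-2-3≡ones w valid)
erase-2-3≡ones (2 ∷ w) (inj₂ (inj₁ refl) ∷ valid)        = erase-2-3≡ones w valid
erase-2-3≡ones (3 ∷ w) (inj₂ (inj₂ refl) ∷ valid)        = erase-2-3≡ones w valid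

∈-compositions : ∀ k l m w → w ∈ compositions k l m ⇔ HasParts k l m w
∈-compositions k l m w = mk⇔ sound complete
  where
  sound : w ∈ compositions k l m → HasParts k l m w
  sound w∈ with find (∈-concatMap⁻ (interleavings 3 k) {xs = twosAndOnes l m} w∈)
  ... | u , u∈ , w∈u with Equivalence.to (∈-twosAndOnes l m u) u∈
                        | Equivalence.to (∈-interleavings 3 k u w (∈-twosAndOnes⇒count3≡0 l m u∈)) w∈u
  ... | c₂ , e₂ | c₃ , refl =
    All-erase⁻ w (All-erase⁻ (erase 3 w) ones-valid (inj₂ (inj₁ refl))) (inj₂ (inj₂ refl)) ,
    c₃ ,
    trans (sym (count-erase w (λ ()))) c₂ ,
    trans (sym (count-erase w (λ ())))
          (trans (sym (count-erase (erase 3 w) (λ ()))) (trans (cong (count 1) e₂) (count-replicate 1 m)))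
    where
    ones-valid : All ValidSize (erase 2 (erase 3 w))
    ones-valid = subst (All ValidSize) (sym e₂) (All.replicate⁺ m (inj₁ refl))
  complete : HasParts k l m w → w ∈ compositions k l m
  complete (valid , c₃ , c₂ , c₁) =
    ∈-concatMap⁺ (interleavings 3 k) (lose u∈ (∈-interleavings⁺ 3 k w c₃))
    where
    u∈ : erase 3 w ∈ twosAndOnes l m
    u∈ = Equivalence.from (∈-twosAndOnes l m (erase 3 w))
           (trans (count-erase w (λ ())) c₂ ,
            trans (erase-2-3≡ones w valid) (cong (λ m → replicate m 1) c₁))

compositions-unique : ∀ k l m → Unique (compositions k l m)
compositions-unique k l m =
  Unique-concatMap⁺ (interleavings 3 k) (erase 3) erase-retracts
    (λ u∈ → interleavings-unique 3 k _ (∈-twosAndOnes⇒count3≡0 l m u∈))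
    (interleavings-unique 2 l (replicate m 1) (count-2-ones≡0 m))
  where
  erase-retracts : ∀ {u w} → u ∈ twosAndOnes l m → w ∈ interleavings 3 k u → erase 3 w ≡ u
  erase-retracts {u} {w} u∈ w∈ =
    proj₂ (Equivalence.to (∈-interleavings 3 k u w (∈-twosAndOnes⇒count3≡0 l m u∈)) w∈)

length-compositions : ∀ k l m → length (compositions k l m) ≡ ((m + l) C l) * ((l + m + k) C k)
length-compositions k l m = begin
  length (compositions k l m)
    ≡⟨ length-concatMap-const (interleavings 3 k) inner-length ⟩
  length (twosAndOnes l m) * ((l + m + k) C k)
    ≡⟨ cong (_* ((l + m + k) C k)) (length-interleavings 2 l (replicate m 1)) ⟩
  ((length (replicate m 1) + l) C l) * ((l + m + k) C k)
    ≡⟨ cong (λ n → ((n + l) C l) * ((l + m + k) C k)) (length-replicate m) ⟩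
  ((m + l) C l) * ((l + m + k) C k)
    ∎
  where
  open ≡-Reasoning
  inner-length : ∀ {u} → u ∈ twosAndOnes l m → length (interleavings 3 k u) ≡ (l + m + k) C k
  inner-length {u} u∈ =
    trans (length-interleavings 3 k u)
          (cong (λ n → (n + k) C k)
                (trans (length-∈-interleavings 2 l (replicate m 1) (count-2-ones≡0 m) u∈)
                       (cong (l +_) (length-replicate m))))

range : ℕ → ℕ → List ℕ
range p zero    = []
range p (suc n) = p ∷ range (suc p) n

applyUpTo≡range : ∀ (f : ℕ → ℕ) p n → (∀ i → f i ≡ p + i) → applyUpTo f n ≡ range p n
applyUpTo≡range f p zero    _     = refl
applyUpTo≡range f p (suc n) f≗p+ =
  cong₂ _∷_ (trans (f≗p+ 0) (+-identityʳ p))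
            (applyUpTo≡range (f ∘ suc) (suc p) n (λ i → trans (f≗p+ (suc i)) (+-suc p i)))

cells≡range : ∀ p s → cells (tile p s) ≡ range p s
cells≡range p s = trans (map-upTo (p +_) s) (applyUpTo≡range (p +_) p s (λ _ → refl))

upTo≡range : ∀ n → upTo n ≡ range 0 n
upTo≡range n = applyUpTo≡range (λ i → i) 0 n (λ _ → refl)

range-++ : ∀ p s r → range p (s + r) ≡ range p s ++ range (p + s) r
range-++ p zero    r = cong (λ q → range q r) (sym (+-identityʳ p))
range-++ p (suc s) r =
  cong (p ∷_) (trans (range-++ (suc p) s r)
                     (cong (λ q → range (suc p) s ++ range q r) (sym (+-suc p s))))

length-range : ∀ p n → length (range p n) ≡ n
length-range p zero    = refl
length-range p (suc n) = cong suc (length-range (suc p) n)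

∈-range⇒≤ : ∀ {p n x} → x ∈ range p n → p ≤ x
∈-range⇒≤ {n = suc n} (here refl) = ≤-refl
∈-range⇒≤ {n = suc n} (there x∈) = <⇒≤ (∈-range⇒≤ x∈)

∈-range⇒lower∈range : ∀ {p n x} → x ∈ range p n → p ∈ range p n
∈-range⇒lower∈range {n = suc n} _ = here refl

++-cancelˡ-↭ : ∀ {A : Set} (xs : List A) {ys zs : List A} → xs ++ ys ↭ xs ++ zs → ys ↭ zs
++-cancelˡ-↭ []       ys↭zs = ys↭zs
++-cancelˡ-↭ (x ∷ xs) ys↭zs = ++-cancelˡ-↭ xs (drop-∷ ys↭zs)

ValidSize⇒0< : ∀ {s} → ValidSize s → 0 < s
ValidSize⇒0< (inj₁ refl)        = s≤s z≤n
ValidSize⇒0< (inj₂ (inj₁ refl)) = s≤s z≤n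
ValidSize⇒0< (inj₂ (inj₂ refl)) = s≤s z≤n

start∈cells : ∀ {t} → ValidSize (size t) → start t ∈ cells t
start∈cells {tile p s} valid with ValidSize⇒0< valid
... | s≤s _ = subst (p ∈_) (sym (cells≡range p s)) (here refl)

∈-cells⇒start≤ : ∀ {t x} → x ∈ cells t → start t ≤ x
∈-cells⇒start≤ {tile p s} x∈ = ∈-range⇒≤ (subst (_ ∈_) (cells≡range p s) x∈)

_≺_ : Tile → Tile → Set
t ≺ u = start t < start u

IsTilingFrom : ℕ → ℕ → List Tile → Set
IsTilingFrom p n ts =
  All (λ t → ValidSize (size t)) ts
  × Linked _≺_ ts
  × (concatMap cells ts ↭ range p n)

IsTiling⇔IsTilingFrom0 : ∀ n ts → IsTiling n ts ⇔ IsTilingFrom 0 n ts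
IsTiling⇔IsTilingFrom0 n ts =
  mk⇔ (λ (valid , sorted , covers) → valid , sorted , subst (_ ↭_) (upTo≡range n) covers)
      (λ (valid , sorted , covers) → valid , sorted , subst (_ ↭_) (sym (upTo≡range n)) covers)

layout : ℕ → List ℕ → List Tile
layout p []      = []
layout p (s ∷ w) = tile p s ∷ layout (p + s) w

map-size-layout : ∀ p w → map size (layout p w) ≡ w
map-size-layout p []      = refl
map-size-layout p (s ∷ w) = cong (s ∷_) (map-size-layout (p + s) w)

cells-layout : ∀ p w → concatMap cells (layout p w) ≡ range p (sum w)
cells-layout p []      = refl
cells-layout p (s ∷ w) =
  trans (cong₂ _++_ (cells≡range p s) (cells-layout (p + s) w)) (sym (range-++ p s (sum w)))

layout-IsTilingFrom : ∀ p w → All ValidSize w → IsTilingFrom p (sum w) (layout p w)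
layout-IsTilingFrom p w valid = All.map⁻ (subst (All ValidSize) (sym (map-size-layout p w)) valid) ,
                                sorted p w valid ,
                                ↭-reflexive (cells-layout p w)
  where
  sorted : ∀ p w → All ValidSize w → Linked _≺_ (layout p w)
  sorted p []           []          = []
  sorted p (s ∷ [])     (_ ∷ [])    = [-]
  sorted p (s ∷ s′ ∷ w) (v ∷ valid) = m<m+n p (ValidSize⇒0< v) ∷ sorted (p + s) (s′ ∷ w) valid

-- p is covered by some tile, and tiles are sorted by start and begin at their least cell.
first-tile-starts-at : ∀ {p n t ts} → IsTilingFrom p n (t ∷ ts) → start t ≡ p
first-tile-starts-at {p} {n} {t} {ts} (valid ∷ _ , sorted , covers) = ≤-antisym start≤p p≤start
  where
  start∈range : start t ∈ range p n
  start∈range = ∈-resp-↭ covers (∈-++⁺ˡ (start∈cells valid))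
  p≤start : p ≤ start t
  p≤start = ∈-range⇒≤ start∈range
  later-start-after : All (t ≺_) ts
  later-start-after with Linked⇒AllPairs (λ {t} {u} {v} → <-trans {start t} {start u} {start v}) sorted
  ... | t≺ts ∷ _ = t≺ts
  start≤p : start t ≤ p
  start≤p with ∈-++⁻ (cells t) (∈-resp-↭ (↭-sym covers) (∈-range⇒lower∈range start∈range))
  ... | inj₁ p∈t  = ∈-cells⇒start≤ p∈t
  ... | inj₂ p∈ts with find (∈-concatMap⁻ cells {xs = ts} p∈ts)
  ...   | u , u∈ts , p∈u = <⇒≤ (≤-trans (All.lookup later-start-after u∈ts) (∈-cells⇒start≤ p∈u))

IsTilingFrom-tail : ∀ {p n s ts} → IsTilingFrom p n (tile p s ∷ ts) →
                    IsTilingFrom (p + s) (length (concatMap cells ts)) ts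
IsTilingFrom-tail {p} {n} {s} {ts} (_ ∷ valid , sorted , covers) =
  valid , Linked.tail sorted , ++-cancelˡ-↭ (range p s) covers′
  where
  rest = concatMap cells ts
  covers-range : range p s ++ rest ↭ range p n
  covers-range = subst (λ c → c ++ rest ↭ range p n) (cells≡range p s) covers
  n≡s+rest : n ≡ s + length rest
  n≡s+rest = begin
    n                                ≡⟨ length-range p n ⟨
    length (range p n)               ≡⟨ ↭-length covers-range ⟨
    length (range p s ++ rest)       ≡⟨ length-++ (range p s) ⟩
    length (range p s) + length rest ≡⟨ cong (_+ length rest) (length-range p s) ⟩
    s + length rest                  ∎
    where open ≡-Reasoning
  covers′ : range p s ++ rest ↭ range p s ++ range (p + s) (length rest)
  covers′ = ↭-trans covers-range
                    (↭-reflexive (trans (cong (range p) n≡s+rest) (range-++ p s (length rest))))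

tiling≡layout : ∀ p n ts → IsTilingFrom p n ts → ts ≡ layout p (map size ts)
tiling≡layout p n []              _      = refl
tiling≡layout p n (tile q s ∷ ts) tiling with first-tile-starts-at tiling
... | refl = cong (tile q s ∷_) (tiling≡layout (q + s) _ ts (IsTilingFrom-tail tiling))

countSize≡count : ∀ s ts → countSize s ts ≡ count s (map size ts)
countSize≡count s []       = refl
countSize≡count s (t ∷ ts) with size t ≟ s
... | yes refl = trans (cong length (filter-accept (λ t → size t ≟ s) {x = t} {xs = ts} refl))
                       (cong suc (countSize≡count s ts))
... | no  ≢s   = trans (cong length (filter-reject (λ t → size t ≟ s) {x = t} {xs = ts} ≢s))
                       (countSize≡count s ts)

sum-sizes : ∀ w → All ValidSize w → sum w ≡ 3 * count 3 w + 2 * count 2 w + count 1 w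
sum-sizes []      [] = refl
sum-sizes (1 ∷ w) (inj₁ refl ∷ valid) =
  trans (cong (1 +_) (sum-sizes w valid)) (monomer (count 3 w) (count 2 w) (count 1 w))
  where
  monomer : ∀ x y z → 1 + (3 * x + 2 * y + z) ≡ 3 * x + 2 * y + (1 + z)
  monomer = solve-∀
sum-sizes (2 ∷ w) (inj₂ (inj₁ refl) ∷ valid) =
  trans (cong (2 +_) (sum-sizes w valid)) (dimer (count 3 w) (count 2 w) (count 1 w))
  where
  dimer : ∀ x y z → 2 + (3 * x + 2 * y + z) ≡ 3 * x + 2 * (1 + y) + z
  dimer = solve-∀
sum-sizes (3 ∷ w) (inj₂ (inj₂ refl) ∷ valid) =
  trans (cong (3 +_) (sum-sizes w valid)) (trimer (count 3 w) (count 2 w) (count 1 w))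
  where
  trimer : ∀ x y z → 3 + (3 * x + 2 * y + z) ≡ 3 * (1 + x) + 2 * y + z
  trimer = solve-∀

HasTileCounts : ℕ → ℕ → ℕ → List Tile → Set
HasTileCounts k l m ts = countSize 3 ts ≡ k × countSize 2 ts ≡ l × countSize 1 ts ≡ m

tilingsWithParts : ℕ → ℕ → ℕ → List (List Tile)
tilingsWithParts k l m = map (layout 0) (compositions k l m)

tilingsWithParts-unique : ∀ k l m → Unique (tilingsWithParts k l m)
tilingsWithParts-unique k l m = Unique.map⁺ layout-injective (compositions-unique k l m)
  where
  layout-injective : ∀ {v w} → layout 0 v ≡ layout 0 w → v ≡ w
  layout-injective {v} {w} eq =
    trans (sym (map-size-layout 0 v)) (trans (cong (map size) eq) (map-size-layout 0 w))

∈-tilingsWithParts : ∀ k l m ts →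
  ts ∈ tilingsWithParts k l m ⇔
  (IsTiling (3 * k + 2 * l + m) ts × HasTileCounts k l m ts)
∈-tilingsWithParts k l m ts = mk⇔ sound complete
  where
  countSize-layout : ∀ s w → countSize s (layout 0 w) ≡ count s w
  countSize-layout s w = trans (countSize≡count s (layout 0 w)) (cong (count s) (map-size-layout 0 w))
  sound : ts ∈ tilingsWithParts k l m →
          IsTiling (3 * k + 2 * l + m) ts × HasTileCounts k l m ts
  sound ts∈ with ∈-map⁻ (layout 0) ts∈
  ... | w , w∈ , refl with Equivalence.to (∈-compositions k l m w) w∈
  ... | valid , c₃ , c₂ , c₁ =
    subst (λ n → IsTiling n (layout 0 w)) sum≡
          (Equivalence.from (IsTiling⇔IsTilingFrom0 (sum w) (layout 0 w)) (layout-IsTilingFrom 0 w valid)) ,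
    trans (countSize-layout 3 w) c₃ ,
    trans (countSize-layout 2 w) c₂ ,
    trans (countSize-layout 1 w) c₁
    where
    sum≡ : sum w ≡ 3 * k + 2 * l + m
    sum≡ = trans (sum-sizes w valid) (cong₂ _+_ (cong₂ (λ x y → 3 * x + 2 * y) c₃ c₂) c₁)
  complete : IsTiling (3 * k + 2 * l + m) ts × HasTileCounts k l m ts →
             ts ∈ tilingsWithParts k l m
  complete (tiling , c₃ , c₂ , c₁) =
    subst (_∈ tilingsWithParts k l m) (sym (tiling≡layout 0 _ ts tiling₀))
          (∈-map⁺ (layout 0) (Equivalence.from (∈-compositions k l m (map size ts)) parts))
    where
    tiling₀ = Equivalence.to (IsTiling⇔IsTilingFrom0 _ ts) tiling
    parts : HasParts k l m (map size ts)
    parts = All.map⁺ (proj₁ tiling) ,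
            trans (sym (countSize≡count 3 ts)) c₃ ,
            trans (sym (countSize≡count 2 ts)) c₂ ,
            trans (sym (countSize≡count 1 ts)) c₁

length-tilingsWithParts : ∀ k l m → length (tilingsWithParts k l m) ≡ ((m + l) C l) * ((l + m + k) C k)
length-tilingsWithParts k l m = trans (length-map (layout 0) (compositions k l m)) (length-compositions k l m)

[3k+2l+m]∸[3k+l]≡m+l : ∀ k l m → 3 * k + 2 * l + m ∸ (3 * k + l) ≡ m + l
[3k+2l+m]∸[3k+l]≡m+l k l m =
  trans (cong (_∸ (3 * k + l)) (regroup k l m)) (m+n∸m≡n (3 * k + l) (m + l))
  where
  regroup : ∀ k l m → 3 * k + 2 * l + m ≡ 3 * k + l + (m + l)
  regroup = solve-∀

[3k+2l+m]∸[2k+l]≡l+m+k : ∀ k l m → 3 * k + 2 * l + m ∸ (2 * k + l) ≡ l + m + k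
[3k+2l+m]∸[2k+l]≡l+m+k k l m =
  trans (cong (_∸ (2 * k + l)) (regroup k l m)) (m+n∸m≡n (2 * k + l) (l + m + k))
  where
  regroup : ∀ k l m → 3 * k + 2 * l + m ≡ 2 * k + l + (l + m + k)
  regroup = solve-∀

theorem12 : (n k l : ℕ) → 3 * k + 2 * l ≤ n →
    Σ (List (List Tile)) λ gs →
      Unique gs
      × (∀ ts → (ts ∈ gs) ⇔ (IsTiling n ts × countSize 3 ts ≡ k × countSize 2 ts ≡ l × countSize 1 ts ≡ n ∸ (3 * k + 2 * l)))
      × length gs ≡ ((n ∸ (3 * k + l)) C l) * ((n ∸ (2 * k + l)) C k)
theorem12 n k l 3k+2l≤n with m≤n⇒∃[o]m+o≡n 3k+2l≤n
... | m , refl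
  rewrite m+n∸m≡n (3 * k + 2 * l) m
        | [3k+2l+m]∸[3k+l]≡m+l k l m
        | [3k+2l+m]∸[2k+l]≡l+m+k k l m
  = tilingsWithParts k l m ,
    tilingsWithParts-unique k l m ,
    ∈-tilingsWithParts k l m ,
    length-tilingsWithParts k l m
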